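{- Let $C_{2n+1}$ be the cycle on $2n+1$ vertices. If $A$ is a center set of $C_{2n+1}$, then either $|A|\le n$ or $|A|=2n+1$.
   Context: $d$ is shortest-path distance. For nonempty $S\subseteq V$, $e_S(v)=\max_{x\in S}d(v,x)$ and $C_S(G)=\{v\in V: e_S(v)\le e_S(x)\ \forall x\in V\}$. A set $A\subseteq V$ is a center set of $G$ if $A=C_S(G)$ for some nonempty $S\subseteq V$. -}

module Defs where

open import Data.Nat using (ℕ; zero; suc; _+_; _*_; _≤_; _⊔_; _%_; _≡ᵇ_)
open import Data.Bool using (Bool; true; false; _∨_; _∧_; if_then_else_)
open import Data.Fin using (Fin; toℕ; _≟_)
open import Data.Fin.Subset using (Subset; Nonempty; _∈_)
open import Data.List using (List; allFin; map; foldr)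
open import Data.Bool.ListAction using (any)
open import Data.Vec using (lookup)
open import Data.Product using (Σ; _×_)
open import Function.Bundles using (_⇔_)
open import Relation.Nullary.Decidable using (⌊_⌋)

Graph : ℕ → Set
Graph m = Fin m → Fin m → Bool

reach : ∀ {m} → Graph m → ℕ → Fin m → Fin m → Bool
reach G zero    u v = ⌊ u ≟ v ⌋
reach {m} G (suc k) u v =
  reach G k u v ∨ any (λ w → G u w ∧ reach G k w v) (allFin m)

-- least k ≤ n with p k (returns n if there is none)
leastUpTo : (ℕ → Bool) → ℕ → ℕ
leastUpTo p zero    = zero
leastUpTo p (suc n) = if p zero then zero else suc (leastUpTo (λ k → p (suc k)) n)

-- shortest-path distance d(u,v) (for a connected graph on m vertices,
-- every distance is < m, so the search up to m is exhaustive)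
dist : ∀ {m} → Graph m → Fin m → Fin m → ℕ
dist {m} G u v = leastUpTo (λ k → reach G k u v) m

-- e_S(v) = max_{x ∈ S} d(v,x)   (S nonempty in all uses; distances are ≥ 0)
ecc : ∀ {m} → Graph m → Subset m → Fin m → ℕ
ecc {m} G S v =
  foldr _⊔_ 0 (map (λ x → if lookup S x then dist G v x else 0) (allFin m))

InCenter : ∀ {m} → Graph m → Subset m → Fin m → Set
InCenter {m} G S v = ∀ (x : Fin m) → ecc G S v ≤ ecc G S x

IsCenterSet : ∀ {m} → Graph m → Subset m → Set
IsCenterSet {m} G A =
  Σ (Subset m) λ S → Nonempty S × (∀ (v : Fin m) → (v ∈ A ⇔ InCenter G S v))

cycle : ∀ m → Graph (suc m)
cycle m i j =
  ((suc (toℕ i) % suc m) ≡ᵇ toℕ j) ∨ ((suc (toℕ j) % suc m) ≡ᵇ toℕ i)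

-- Let S be nonempty, C = C_S(C_{2n+1}) and r the common eccentricity of the vertices of C.
-- All distances in C_{2n+1} are at most n, so r ≤ n. If r = n, every vertex has eccentricity
-- at most r, hence C is the whole cycle. If r < n, then C contains no two vertices v, v + 2:
-- for every x ∈ S, a path of length ≤ r < n from v to x and one from v + 2 to x cannot go
-- round the cycle, so one of them passes through v + 1 and d(v + 1, x) < r, contradicting the
-- minimality of r. Thus C and its rotation by two are disjoint subsets of the 2n + 1 vertices,
-- and 2|C| ≤ 2n + 1.
module Submission where

open import Defs
open import Data.Bool using (Bool; true; false; T; if_then_else_)
open import Data.Bool.Properties using (T-∨; T-∧)
open import Data.Empty using (⊥-elim)
open import Data.Fin using (Fin; zero; suc; toℕ; fromℕ<)
open import Data.Fin.Properties using (toℕ-injective; toℕ<n; toℕ-fromℕ<; any?)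
open import Data.Fin.Subset using (Subset; Nonempty; _∈_; _∉_; ∁; ⊤; ∣_∣; inside; outside)
open import Data.Fin.Subset.Properties
  using (_∈?_; ∣⊤∣≡n; p⊆q⇒∣p∣≤∣q∣; x∉p⇒x∈∁p; ∣∁p∣≡n∸∣p∣; ∣p∣≤n)
open import Data.List using ([]; _∷_; allFin; map; foldr)
import Data.List.Membership.Propositional as List
open import Data.List.Membership.Propositional.Properties using (∈-allFin)
open import Data.List.Relation.Unary.Any using (here; there; satisfied)
open import Data.List.Relation.Unary.Any.Properties using (any⁺; any⁻)
open import Data.Nat
  using (ℕ; zero; suc; _+_; _*_; _∸_; _≤_; _<_; _⊔_; _≡ᵇ_; z≤n; s≤s; NonZero; _≤′_; ≤′-refl; ≤′-step)
open import Data.Nat.Properties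
  using ( ≤-refl; ≤-reflexive; ≤-trans; ≤-antisym; ≤-<-trans; <-irrefl; <⇒≤; ≤-pred; ≰⇒>; _≤?_
        ; ≤⇒≤′; n≤1+n; m≤n⇒m≤1+n; m≤n⇒m<n∨m≡n; m≤m+n; +-mono-≤; +-monoʳ-≤; ∸-monoʳ-≤
        ; +-assoc; +-comm; +-identityʳ; +-suc; suc-injective; 0≢1+n
        ; m+[n∸m]≡n; m∸n+n≡m; m+n∸m≡n; ⊔-lub; m≤m⊔n; m≤n⊔m; ≡ᵇ⇒≡; ≡⇒≡ᵇ
        ; module ≤-Reasoning)
open import Data.Nat.DivMod
  using (_%_; m%n<n; %-distribˡ-+; m%n%n≡m%n; m<n⇒m%n≡m; [m+n]%n≡m%n; n%n≡0)
open import Data.Product using (∃-syntax; _×_; _,_) renaming (map₂ to ×-map₂)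
open import Data.Sum using (_⊎_; inj₁; inj₂) renaming (map to ⊎-map)
open import Data.Vec using (Vec; []; _∷_; _∷ʳ_; lookup)
open import Data.Vec.Properties using ([]=⇒lookup; lookup⇒[]=)
open import Function using (_∘_)
open import Function.Bundles using (Equivalence; _⇔_; mk⇔)
open import Relation.Nullary using (¬_)
open import Relation.Nullary.Decidable using (yes; no; _×-dec_; toWitness; fromWitness)
open import Relation.Binary.PropositionalEquality
  using (_≡_; refl; sym; trans; cong; subst; module ≡-Reasoning)

open Equivalence using (to; from)

%-absorbʳ : ∀ m n d .{{_ : NonZero d}} → (m + n % d) % d ≡ (m + n) % d
%-absorbʳ m n d = begin
  (m + n % d) % d            ≡⟨ %-distribˡ-+ m (n % d) d ⟩
  (m % d + n % d % d) % d    ≡⟨ cong (λ r → (m % d + r) % d) (m%n%n≡m%n n d) ⟩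
  (m % d + n % d) % d        ≡⟨ %-distribˡ-+ m n d ⟨
  (m + n) % d                ∎
  where open ≡-Reasoning

m+m≤1+2n⇒m≤n : ∀ m n → m + m ≤ suc (2 * n) → m ≤ n
m+m≤1+2n⇒m≤n zero    n       _ = z≤n
m+m≤1+2n⇒m≤n (suc m) zero    (s≤s h) rewrite +-suc m m with () ← h
m+m≤1+2n⇒m≤n (suc m) (suc n) (s≤s h) rewrite +-suc m m | +-suc n (n + 0) =
  s≤s (m+m≤1+2n⇒m≤n m n (≤-pred h))

foldr-⊔-lub : ∀ {A : Set} (f : A → ℕ) {k} xs → (∀ x → f x ≤ k) → foldr _⊔_ 0 (map f xs) ≤ k
foldr-⊔-lub f []       _ = z≤n
foldr-⊔-lub f (x ∷ xs) h = ⊔-lub (h x) (foldr-⊔-lub f xs h)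

foldr-⊔-upper : ∀ {A : Set} (f : A → ℕ) {x} xs → x List.∈ xs → f x ≤ foldr _⊔_ 0 (map f xs)
foldr-⊔-upper f (y ∷ xs) (here refl)  = m≤m⊔n (f y) _
foldr-⊔-upper f (y ∷ xs) (there x∈xs) = ≤-trans (foldr-⊔-upper f xs x∈xs) (m≤n⊔m (f y) _)

leastUpTo-minimal : ∀ (p : ℕ → Bool) n {j} → T (p j) → leastUpTo p n ≤ j
leastUpTo-minimal p zero    pj = z≤n
leastUpTo-minimal p (suc n) {j} pj with p zero in eq | j
... | true  | _     = z≤n
... | false | zero  = ⊥-elim (subst T eq pj)
... | false | suc j = s≤s (leastUpTo-minimal (p ∘ suc) n pj)

leastUpTo-satisfies : ∀ (p : ℕ → Bool) n {j} → j ≤ n → T (p j) → T (p (leastUpTo p n))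
leastUpTo-satisfies p zero    z≤n pj = pj
leastUpTo-satisfies p (suc n) {j} j≤n pj with p zero in eq | j | j≤n
... | true  | _     | _        = subst T (sym eq) _
... | false | zero  | _        = ⊥-elim (subst T eq pj)
... | false | suc j | s≤s j≤n′ = leastUpTo-satisfies (p ∘ suc) n j≤n′ pj

module _ {m} (G : Graph m) where

  reach-suc : ∀ {k u v} → T (reach G k u v) → T (reach G (suc k) u v)
  reach-suc r = from T-∨ (inj₁ r)

  reach-step : ∀ {k u w v} → T (G u w) → T (reach G k w v) → T (reach G (suc k) u v)
  reach-step {w = w} uw wv =
    from T-∨ (inj₂ (any⁺ _ (List.lose (∈-allFin w) (from T-∧ (uw , wv)))))

  reach-suc⁻ : ∀ {k u v} → T (reach G (suc k) u v) →
               T (reach G k u v) ⊎ ∃[ w ] T (G u w) × T (reach G k w v)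
  reach-suc⁻ r with to T-∨ r
  ... | inj₁ r′ = inj₁ r′
  ... | inj₂ r′ = inj₂ (×-map₂ (to T-∧) (satisfied (any⁻ _ (allFin m) r′)))

  reach-mono : ∀ {j k u v} → j ≤ k → T (reach G j u v) → T (reach G k u v)
  reach-mono = go ∘ ≤⇒≤′
    where
    go : ∀ {j k u v} → j ≤′ k → T (reach G j u v) → T (reach G k u v)
    go ≤′-refl           r = r
    go (≤′-step {k} j≤k) r = reach-suc {k} (go j≤k r)

  dist-≤ : ∀ {k u v} → T (reach G k u v) → dist G u v ≤ k
  dist-≤ = leastUpTo-minimal _ m

  reach-dist : ∀ {k u v} → k ≤ m → T (reach G k u v) → T (reach G (dist G u v) u v)
  reach-dist = leastUpTo-satisfies _ m

module _ {m} (G : Graph m) (S : Subset m) where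

  ecc-lub : ∀ {v k} → (∀ x → x ∈ S → dist G v x ≤ k) → ecc G S v ≤ k
  ecc-lub {v} {k} h = foldr-⊔-lub _ (allFin m) bound
    where
    bound : ∀ x → (if lookup S x then dist G v x else 0) ≤ k
    bound x with lookup S x in eq
    ... | true  = h x (lookup⇒[]= x S eq)
    ... | false = z≤n

  dist≤ecc : ∀ {v x} → x ∈ S → dist G v x ≤ ecc G S v
  dist≤ecc {v} {x} x∈S =
    subst (_≤ ecc G S v) (cong (λ b → if b then dist G v x else 0) ([]=⇒lookup x∈S))
      (foldr-⊔-upper (λ y → if lookup S y then dist G v y else 0) (allFin m) (∈-allFin x))

  ecc-<-lub : ∀ {v k} → Nonempty S → (∀ x → x ∈ S → dist G v x < k) → ecc G S v < k
  ecc-<-lub {k = zero}  (s , s∈S) h with () ← h s s∈S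
  ecc-<-lub {k = suc k} _         h = s≤s (ecc-lub (λ x x∈S → ≤-pred (h x x∈S)))

  center-full : ∀ {b v} → (∀ u → ecc G S u ≤ b) → InCenter G S v → b ≤ ecc G S v →
                ∀ u → InCenter G S u
  center-full ecc≤b v∈C b≤ u x = ≤-trans (ecc≤b u) (≤-trans b≤ (v∈C x))

∀∈⇒∣p∣≡n : ∀ {k} (p : Subset k) → (∀ i → i ∈ p) → ∣ p ∣ ≡ k
∀∈⇒∣p∣≡n {k} p all =
  ≤-antisym (∣p∣≤n p) (subst (_≤ ∣ p ∣) (∣⊤∣≡n k) (p⊆q⇒∣p∣≤∣q∣ {p = ⊤} (λ {i} _ → all i)))

disjoint⇒∣p∣+∣q∣≤n : ∀ {k} (p q : Subset k) → (∀ {i} → i ∈ p → i ∉ q) → ∣ p ∣ + ∣ q ∣ ≤ k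
disjoint⇒∣p∣+∣q∣≤n {k} p q disj = begin
  ∣ p ∣ + ∣ q ∣         ≤⟨ +-monoʳ-≤ ∣ p ∣ (p⊆q⇒∣p∣≤∣q∣ (λ i∈q → x∉p⇒x∈∁p (λ i∈p → disj i∈p i∈q))) ⟩
  ∣ p ∣ + ∣ ∁ p ∣       ≡⟨ cong (∣ p ∣ +_) (∣∁p∣≡n∸∣p∣ p) ⟩
  ∣ p ∣ + (k ∸ ∣ p ∣)   ≡⟨ m+[n∸m]≡n (∣p∣≤n p) ⟩
  k                     ∎
  where open ≤-Reasoning

module _ {k : ℕ} where

  open ≡-Reasoning

  infixl 6 _+ᶜ_

  -- Summing in the order j + toℕ u makes toℕ (u +ᶜ 1) the term suc (toℕ u) % suc k used by cycle.
  _+ᶜ_ : Fin (suc k) → ℕ → Fin (suc k)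
  u +ᶜ j = fromℕ< (m%n<n (j + toℕ u) (suc k))

  toℕ-+ᶜ : ∀ u j → toℕ (u +ᶜ j) ≡ (j + toℕ u) % suc k
  toℕ-+ᶜ u j = toℕ-fromℕ< (m%n<n (j + toℕ u) (suc k))

  +ᶜ-identityʳ : ∀ u → u +ᶜ 0 ≡ u
  +ᶜ-identityʳ u = toℕ-injective (trans (toℕ-+ᶜ u 0) (m<n⇒m%n≡m (toℕ<n u)))

  +ᶜ-assoc : ∀ u i j → u +ᶜ i +ᶜ j ≡ u +ᶜ (i + j)
  +ᶜ-assoc u i j = toℕ-injective (begin
    toℕ (u +ᶜ i +ᶜ j)                   ≡⟨ toℕ-+ᶜ (u +ᶜ i) j ⟩
    (j + toℕ (u +ᶜ i)) % suc k          ≡⟨ cong (λ r → (j + r) % suc k) (toℕ-+ᶜ u i) ⟩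
    (j + (i + toℕ u) % suc k) % suc k   ≡⟨ %-absorbʳ j (i + toℕ u) (suc k) ⟩
    (j + (i + toℕ u)) % suc k           ≡⟨ cong (_% suc k) (+-assoc j i (toℕ u)) ⟨
    (j + i + toℕ u) % suc k             ≡⟨ cong (λ r → (r + toℕ u) % suc k) (+-comm j i) ⟩
    (i + j + toℕ u) % suc k             ≡⟨ toℕ-+ᶜ u (i + j) ⟨
    toℕ (u +ᶜ (i + j))                  ∎)

  +ᶜ-suc : ∀ u j → u +ᶜ j +ᶜ 1 ≡ u +ᶜ suc j
  +ᶜ-suc u j = trans (+ᶜ-assoc u j 1) (cong (u +ᶜ_) (+-comm j 1))

  +ᶜ-comm : ∀ u w → u +ᶜ toℕ w ≡ w +ᶜ toℕ u
  +ᶜ-comm u w = toℕ-injective (begin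
    toℕ (u +ᶜ toℕ w)          ≡⟨ toℕ-+ᶜ u (toℕ w) ⟩
    (toℕ w + toℕ u) % suc k   ≡⟨ cong (_% suc k) (+-comm (toℕ w) (toℕ u)) ⟩
    (toℕ u + toℕ w) % suc k   ≡⟨ toℕ-+ᶜ w (toℕ u) ⟨
    toℕ (w +ᶜ toℕ u)          ∎)

  +ᶜ-period : ∀ u → u +ᶜ suc k ≡ u
  +ᶜ-period u = toℕ-injective (begin
    toℕ (u +ᶜ suc k)          ≡⟨ toℕ-+ᶜ u (suc k) ⟩
    (suc k + toℕ u) % suc k   ≡⟨ cong (_% suc k) (+-comm (suc k) (toℕ u)) ⟩
    (toℕ u + suc k) % suc k   ≡⟨ [m+n]%n≡m%n (toℕ u) (suc k) ⟩
    toℕ u % suc k             ≡⟨ m<n⇒m%n≡m (toℕ<n u) ⟩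
    toℕ u                     ∎)

  +ᶜ-cancelʳ : ∀ {u v} j → j ≤ suc k → u +ᶜ j ≡ v +ᶜ j → u ≡ v
  +ᶜ-cancelʳ {u} {v} j j≤ e = begin
    u                         ≡⟨ +ᶜ-period u ⟨
    u +ᶜ suc k                ≡⟨ cong (u +ᶜ_) (m+[n∸m]≡n j≤) ⟨
    u +ᶜ (j + (suc k ∸ j))    ≡⟨ +ᶜ-assoc u j (suc k ∸ j) ⟨
    u +ᶜ j +ᶜ (suc k ∸ j)     ≡⟨ cong (_+ᶜ (suc k ∸ j)) e ⟩
    v +ᶜ j +ᶜ (suc k ∸ j)     ≡⟨ +ᶜ-assoc v j (suc k ∸ j) ⟩
    v +ᶜ (j + (suc k ∸ j))    ≡⟨ cong (v +ᶜ_) (m+[n∸m]≡n j≤) ⟩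
    v +ᶜ suc k                ≡⟨ +ᶜ-period v ⟩
    v                         ∎

  +ᶜ-cancelˡ : ∀ u {i j} → i < suc k → j < suc k → u +ᶜ i ≡ u +ᶜ j → i ≡ j
  +ᶜ-cancelˡ u {i} {j} i< j< e = begin
    i                ≡⟨ toℕ-fromℕ< i< ⟨
    toℕ (fromℕ< i<)  ≡⟨ cong toℕ (+ᶜ-cancelʳ (toℕ u) (<⇒≤ (toℕ<n u))
                                   (trans (swap i<) (trans e (sym (swap j<))))) ⟩
    toℕ (fromℕ< j<)  ≡⟨ toℕ-fromℕ< j< ⟩
    j                ∎
    where
    swap : ∀ {a} (a< : a < suc k) → fromℕ< a< +ᶜ toℕ u ≡ u +ᶜ a
    swap a< = trans (+ᶜ-comm (fromℕ< a<) u) (cong (u +ᶜ_) (toℕ-fromℕ< a<))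

  offset : ∀ u v → ∃[ d ] d < suc k × u +ᶜ d ≡ v
  offset u v = toℕ w , toℕ<n w , (begin
    u +ᶜ toℕ w                      ≡⟨ +ᶜ-comm u w ⟩
    v +ᶜ (suc k ∸ toℕ u) +ᶜ toℕ u   ≡⟨ +ᶜ-assoc v (suc k ∸ toℕ u) (toℕ u) ⟩
    v +ᶜ (suc k ∸ toℕ u + toℕ u)    ≡⟨ cong (v +ᶜ_) (m∸n+n≡m (<⇒≤ (toℕ<n u))) ⟩
    v +ᶜ suc k                      ≡⟨ +ᶜ-period v ⟩
    v                               ∎)
    where w = v +ᶜ (suc k ∸ toℕ u)

  -- The form of i +ᶜ 1 ≡ j that can be followed by induction along a vector.
  CyclicSuccessor : Fin (suc k) → Fin (suc k) → Set
  CyclicSuccessor i j = suc (toℕ i) ≡ toℕ j ⊎ toℕ i ≡ k × j ≡ zero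

  +ᶜ1-cyclicSuccessor : ∀ i → CyclicSuccessor i (i +ᶜ 1)
  +ᶜ1-cyclicSuccessor i with m≤n⇒m<n∨m≡n (≤-pred (toℕ<n i))
  ... | inj₁ i<k = inj₁ (sym (trans (toℕ-+ᶜ i 1) (m<n⇒m%n≡m (s≤s i<k))))
  ... | inj₂ i≡k = inj₂ (i≡k , toℕ-injective (begin
    toℕ (i +ᶜ 1)          ≡⟨ toℕ-+ᶜ i 1 ⟩
    suc (toℕ i) % suc k   ≡⟨ cong (λ r → suc r % suc k) i≡k ⟩
    suc k % suc k         ≡⟨ n%n≡0 (suc k) ⟩
    0                     ∎))

rotateˡ : ∀ {A : Set} {k} → Vec A (suc k) → Vec A (suc k)
rotateˡ (x ∷ xs) = xs ∷ʳ x

lookup-∷ʳ : ∀ {A : Set} {k} x (xs : Vec A k) i j → CyclicSuccessor i j →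
            lookup (xs ∷ʳ x) i ≡ lookup (x ∷ xs) j
lookup-∷ʳ x []       zero    zero          _                = refl
lookup-∷ʳ x (y ∷ ys) zero    (suc zero)    _                = refl
lookup-∷ʳ x (y ∷ ys) zero    zero          (inj₁ ())
lookup-∷ʳ x (y ∷ ys) zero    zero          (inj₂ (() , _))
lookup-∷ʳ x (y ∷ ys) zero    (suc (suc j)) (inj₁ ())
lookup-∷ʳ x (y ∷ ys) zero    (suc (suc j)) (inj₂ (_ , ()))
lookup-∷ʳ x (y ∷ ys) (suc i) zero          (inj₁ ())
lookup-∷ʳ x (y ∷ ys) (suc i) zero          (inj₂ (i≡k , _)) =
  lookup-∷ʳ x ys i zero (inj₂ (suc-injective i≡k , refl))
lookup-∷ʳ x (y ∷ ys) (suc i) (suc zero)    (inj₁ ())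
lookup-∷ʳ x (y ∷ ys) (suc i) (suc (suc j)) (inj₁ e) =
  lookup-∷ʳ x ys i (suc j) (inj₁ (suc-injective e))
lookup-∷ʳ x (y ∷ ys) (suc i) (suc j)       (inj₂ (_ , ()))

lookup-rotateˡ : ∀ {A : Set} {k} (xs : Vec A (suc k)) i → lookup (rotateˡ xs) i ≡ lookup xs (i +ᶜ 1)
lookup-rotateˡ (x ∷ xs) i = lookup-∷ʳ x xs i (i +ᶜ 1) (+ᶜ1-cyclicSuccessor i)

∈-rotateˡ⁻ : ∀ {k i} (p : Subset (suc k)) → i ∈ rotateˡ p → i +ᶜ 1 ∈ p
∈-rotateˡ⁻ {i = i} p i∈ = lookup⇒[]= _ p (trans (sym (lookup-rotateˡ p i)) ([]=⇒lookup i∈))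

∣∷ʳ∣ : ∀ {k} x (p : Subset k) → ∣ p ∷ʳ x ∣ ≡ ∣ x ∷ p ∣
∣∷ʳ∣ x       []            = refl
∣∷ʳ∣ x       (outside ∷ p) = ∣∷ʳ∣ x p
∣∷ʳ∣ outside (inside ∷ p)  = cong suc (∣∷ʳ∣ outside p)
∣∷ʳ∣ inside  (inside ∷ p)  = cong suc (∣∷ʳ∣ inside p)

∣rotateˡ∣ : ∀ {k} (p : Subset (suc k)) → ∣ rotateˡ p ∣ ≡ ∣ p ∣
∣rotateˡ∣ (x ∷ p) = ∣∷ʳ∣ x p

gap2⇒∣p∣+∣p∣≤n : ∀ {k} (p : Subset (suc k)) → (∀ {i} → i ∈ p → i +ᶜ 2 ∉ p) →
                 ∣ p ∣ + ∣ p ∣ ≤ suc k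
gap2⇒∣p∣+∣p∣≤n {k} p gap =
  subst (λ c → ∣ p ∣ + c ≤ suc k) (trans (∣rotateˡ∣ (rotateˡ p)) (∣rotateˡ∣ p))
    (disjoint⇒∣p∣+∣q∣≤n p (rotateˡ (rotateˡ p)) λ {i} i∈p i∈q →
      gap i∈p (subst (_∈ p) (+ᶜ-assoc i 1 1) (∈-rotateˡ⁻ p (∈-rotateˡ⁻ (rotateˡ p) i∈q))))

module CycleMetric (m : ℕ) where

  Adjacent : Fin (suc m) → Fin (suc m) → Set
  Adjacent u w = u +ᶜ 1 ≡ w ⊎ w +ᶜ 1 ≡ u

  Arc : ℕ → Fin (suc m) → Fin (suc m) → Set
  Arc j u v = u +ᶜ j ≡ v ⊎ v +ᶜ j ≡ u

  Within : ℕ → Fin (suc m) → Fin (suc m) → Set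
  Within k u v = ∃[ j ] j ≤ k × Arc j u v

  T-successor⇔ : ∀ (u w : Fin (suc m)) → T (suc (toℕ u) % suc m ≡ᵇ toℕ w) ⇔ u +ᶜ 1 ≡ w
  T-successor⇔ u w = mk⇔
    (λ t → toℕ-injective (trans (toℕ-+ᶜ u 1) (≡ᵇ⇒≡ _ _ t)))
    (λ e → ≡⇒≡ᵇ _ _ (trans (sym (toℕ-+ᶜ u 1)) (cong toℕ e)))

  T-cycle⇔Adjacent : ∀ (u w : Fin (suc m)) → T (cycle m u w) ⇔ Adjacent u w
  T-cycle⇔Adjacent u w = mk⇔
    (⊎-map (to (T-successor⇔ u w)) (to (T-successor⇔ w u)) ∘ to T-∨)
    (from T-∨ ∘ ⊎-map (from (T-successor⇔ u w)) (from (T-successor⇔ w u)))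

  within-mono : ∀ {k k′ u v} → k ≤ k′ → Within k u v → Within k′ u v
  within-mono k≤k′ (j , j≤k , a) = j , ≤-trans j≤k k≤k′ , a

  arc-step : ∀ {j u w v} → Adjacent u w → Arc j w v → Within (suc j) u v
  arc-step {j} {u} (inj₁ u→w) (inj₁ w→v) =
    suc j , ≤-refl , inj₁ (trans (sym (+ᶜ-assoc u 1 j)) (trans (cong (_+ᶜ j) u→w) w→v))
  arc-step {zero} {v = v} (inj₁ u→w) (inj₂ v→w) =
    1 , s≤s z≤n , inj₁ (trans u→w (trans (sym v→w) (+ᶜ-identityʳ v)))
  arc-step {suc j} {v = v} (inj₁ u→w) (inj₂ v→w) =
    j , m≤n⇒m≤1+n (n≤1+n j) ,
    inj₂ (+ᶜ-cancelʳ 1 (s≤s z≤n) (trans (+ᶜ-suc v j) (trans v→w (sym u→w))))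
  arc-step {j} {v = v} (inj₂ w→u) (inj₂ v→w) =
    suc j , ≤-refl , inj₂ (trans (sym (+ᶜ-suc v j)) (trans (cong (_+ᶜ 1) v→w) w→u))
  arc-step {zero} {w = w} (inj₂ w→u) (inj₁ w→v) =
    1 , s≤s z≤n , inj₂ (trans (cong (_+ᶜ 1) (trans (sym w→v) (+ᶜ-identityʳ w))) w→u)
  arc-step {suc j} {w = w} (inj₂ w→u) (inj₁ w→v) =
    j , m≤n⇒m≤1+n (n≤1+n j) , inj₁ (trans (cong (_+ᶜ j) (sym w→u)) (trans (+ᶜ-assoc w 1 j) w→v))

  reach⇒within : ∀ k {u v} → T (reach (cycle m) k u v) → Within k u v
  reach⇒within zero {u} r = subst (Within 0 u) (toWitness r) (0 , z≤n , inj₁ (+ᶜ-identityʳ u))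
  reach⇒within (suc k) r with reach-suc⁻ (cycle m) {k} r
  ... | inj₁ r′ = within-mono (n≤1+n k) (reach⇒within k r′)
  ... | inj₂ (w , uw , r′) with j , j≤k , a ← reach⇒within k r′ =
    within-mono (s≤s j≤k) (arc-step (to (T-cycle⇔Adjacent _ w) uw) a)

  clockwise-reach : ∀ j u → T (reach (cycle m) j u (u +ᶜ j))
  clockwise-reach zero    u = fromWitness (sym (+ᶜ-identityʳ u))
  clockwise-reach (suc j) u =
    reach-step (cycle m) {j} (from (T-cycle⇔Adjacent u (u +ᶜ 1)) (inj₁ refl))
      (subst (T ∘ reach (cycle m) j (u +ᶜ 1)) (+ᶜ-assoc u 1 j) (clockwise-reach j (u +ᶜ 1)))

  anticlockwise-reach : ∀ j u → T (reach (cycle m) j (u +ᶜ j) u)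
  anticlockwise-reach zero    u = fromWitness (+ᶜ-identityʳ u)
  anticlockwise-reach (suc j) u =
    reach-step (cycle m) {j} (from (T-cycle⇔Adjacent (u +ᶜ suc j) (u +ᶜ j)) (inj₂ (+ᶜ-suc u j)))
      (anticlockwise-reach j u)

  within⇒reach : ∀ {k u v} → Within k u v → T (reach (cycle m) k u v)
  within⇒reach (j , j≤k , inj₁ u→v) =
    reach-mono (cycle m) j≤k (subst (T ∘ reach (cycle m) j _) u→v (clockwise-reach j _))
  within⇒reach {v = v} (j , j≤k , inj₂ v→u) =
    reach-mono (cycle m) j≤k
      (subst (λ u → T (reach (cycle m) j u v)) v→u (anticlockwise-reach j v))

  within⇒dist≤ : ∀ {k u v} → Within k u v → dist (cycle m) u v ≤ k
  within⇒dist≤ = dist-≤ (cycle m) ∘ within⇒reach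

module OddCycle (n : ℕ) where

  open CycleMetric (2 * n)
  open ≡-Reasoning

  ≤n⇒<N : ∀ {a} → a ≤ n → a < suc (2 * n)
  ≤n⇒<N a≤n = s≤s (≤-trans a≤n (m≤m+n n (n + 0)))

  +-<N : ∀ {a b} → a ≤ n → b ≤ n → a + b < suc (2 * n)
  +-<N a≤n b≤n =
    s≤s (≤-trans (+-mono-≤ a≤n b≤n) (≤-reflexive (cong (n +_) (sym (+-identityʳ n)))))

  N∸d≤n : ∀ {d} → n < d → suc (2 * n) ∸ d ≤ n
  N∸d≤n n<d = ≤-trans (∸-monoʳ-≤ (suc (2 * n)) n<d)
                      (≤-reflexive (trans (m+n∸m≡n n (n + 0)) (+-identityʳ n)))

  within-radius : ∀ u v → Within n u v
  within-radius u v with offset u v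
  ... | d , d<N , u→v with d ≤? n
  ...   | yes d≤n = d , d≤n , inj₁ u→v
  ...   | no  d≰n = suc (2 * n) ∸ d , N∸d≤n (≰⇒> d≰n) , inj₂ (begin
    v +ᶜ (suc (2 * n) ∸ d)          ≡⟨ cong (_+ᶜ (suc (2 * n) ∸ d)) u→v ⟨
    u +ᶜ d +ᶜ (suc (2 * n) ∸ d)     ≡⟨ +ᶜ-assoc u d (suc (2 * n) ∸ d) ⟩
    u +ᶜ (d + (suc (2 * n) ∸ d))    ≡⟨ cong (u +ᶜ_) (m+[n∸m]≡n (<⇒≤ d<N)) ⟩
    u +ᶜ suc (2 * n)                ≡⟨ +ᶜ-period u ⟩
    u                               ∎)

  dist-within : ∀ u v → Within (dist (cycle (2 * n)) u v) u v
  dist-within u v = reach⇒within _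
    (reach-dist (cycle (2 * n)) (<⇒≤ (≤n⇒<N ≤-refl)) (within⇒reach (within-radius u v)))

  ecc≤radius : ∀ S u → ecc (cycle (2 * n)) S u ≤ n
  ecc≤radius S u = ecc-lub (cycle (2 * n)) S (λ x _ → within⇒dist≤ (within-radius u x))

  -- Arcs of length ≤ r < n do not wrap around the cycle, so their lengths from u and from
  -- u +ᶜ 2 to x are determined, and the arc through u +ᶜ 1 is shorter.
  within-middle : ∀ {r u x} → r < n → Within r u x → Within r (u +ᶜ 2) x →
                  ∃[ j ] j < r × Arc j (u +ᶜ 1) x
  within-middle {r} {u} {x} r<n (i , i≤r , a) (i′ , i′≤r , a′) = middle a a′
    where
    1≤n : 1 ≤ n
    1≤n = ≤-trans (s≤s z≤n) r<n

    ≤n : ∀ {a} → a ≤ r → a ≤ n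
    ≤n a≤r = ≤-trans a≤r (<⇒≤ r<n)

    <n : ∀ {a} → a ≤ r → suc a ≤ n
    <n a≤r = ≤-trans (s≤s a≤r) r<n

    meet : ∀ a b → a + b ≡ 2 → a ≤ r → b ≤ r → u +ᶜ a ≡ x → ∃[ j ] j < r × Arc j (u +ᶜ 1) x
    meet 0 .2 refl _   b≤r u→x = 1 , b≤r , inj₂ (cong (_+ᶜ 1) (trans (sym u→x) (+ᶜ-identityʳ u)))
    meet 1 .1 refl a≤r _   u→x = 0 , a≤r , inj₁ (trans (+ᶜ-identityʳ (u +ᶜ 1)) u→x)
    meet 2 .0 refl a≤r _   u→x = 1 , a≤r , inj₁ (trans (+ᶜ-assoc u 1 1) u→x)

    middle : Arc i u x → Arc i′ (u +ᶜ 2) x → ∃[ j ] j < r × Arc j (u +ᶜ 1) x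
    middle (inj₁ u→x) (inj₁ u₂→x)
      with refl ← +ᶜ-cancelˡ u (≤n⇒<N (≤n i≤r)) (+-<N 1≤n (<n i′≤r))
                    (trans u→x (sym (trans (sym (+ᶜ-assoc u 2 i′)) u₂→x)))
      = suc i′ , i≤r , inj₁ (trans (+ᶜ-assoc u 1 (suc i′)) u→x)
    middle (inj₂ x→u) (inj₂ x→u₂)
      with refl ← +ᶜ-cancelˡ x (≤n⇒<N (≤n i′≤r)) (+-<N 1≤n (<n i≤r)) (begin
        x +ᶜ i′        ≡⟨ x→u₂ ⟩
        u +ᶜ 2         ≡⟨ cong (_+ᶜ 2) x→u ⟨
        x +ᶜ i +ᶜ 2    ≡⟨ +ᶜ-assoc x i 2 ⟩
        x +ᶜ (i + 2)   ≡⟨ cong (x +ᶜ_) (+-comm i 2) ⟩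
        x +ᶜ (2 + i)   ∎)
      = suc i , i′≤r , inj₂ (trans (sym (+ᶜ-suc x i)) (cong (_+ᶜ 1) x→u))
    middle (inj₁ u→x) (inj₂ x→u₂) =
      meet i i′ (+ᶜ-cancelˡ u (+-<N (≤n i≤r) (≤n i′≤r)) (+-<N 1≤n 1≤n) (begin
        u +ᶜ (i + i′)  ≡⟨ +ᶜ-assoc u i i′ ⟨
        u +ᶜ i +ᶜ i′   ≡⟨ cong (_+ᶜ i′) u→x ⟩
        x +ᶜ i′        ≡⟨ x→u₂ ⟩
        u +ᶜ 2         ∎)) i≤r i′≤r u→x
    middle (inj₂ x→u) (inj₁ u₂→x) = ⊥-elim (0≢1+n (trans around (+-suc i (suc i′))))
      where
      around : 0 ≡ i + (2 + i′)
      around = +ᶜ-cancelˡ x (s≤s z≤n)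
        (subst (_< suc (2 * n)) (sym (+-suc i (suc i′))) (+-<N (<n i≤r) (<n i′≤r))) (begin
          x +ᶜ 0                ≡⟨ +ᶜ-identityʳ x ⟩
          x                     ≡⟨ u₂→x ⟨
          u +ᶜ 2 +ᶜ i′          ≡⟨ +ᶜ-assoc u 2 i′ ⟩
          u +ᶜ (2 + i′)         ≡⟨ cong (_+ᶜ (2 + i′)) x→u ⟨
          x +ᶜ i +ᶜ (2 + i′)    ≡⟨ +ᶜ-assoc x i (2 + i′) ⟩
          x +ᶜ (i + (2 + i′))   ∎)

  center-+ᶜ2-free : ∀ {S v} → Nonempty S → InCenter (cycle (2 * n)) S v →
                    ecc (cycle (2 * n)) S v < n → ¬ InCenter (cycle (2 * n)) S (v +ᶜ 2)
  center-+ᶜ2-free {S} {v} S≠∅ v∈C r<n v₂∈C =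
    <-irrefl refl (≤-<-trans (v∈C (v +ᶜ 1)) (ecc-<-lub (cycle (2 * n)) S S≠∅ closer))
    where
    closer : ∀ x → x ∈ S → dist (cycle (2 * n)) (v +ᶜ 1) x < ecc (cycle (2 * n)) S v
    closer x x∈S with j , j<r , a ← within-middle r<n
        (within-mono (dist≤ecc (cycle (2 * n)) S x∈S) (dist-within v x))
        (within-mono (≤-trans (dist≤ecc (cycle (2 * n)) S x∈S) (v₂∈C v)) (dist-within (v +ᶜ 2) x))
      = ≤-<-trans (within⇒dist≤ (j , ≤-refl , a)) j<r

mainTheorem9 : (n : ℕ) → 1 ≤ n → (A : Subset (suc (2 * n)))
    → IsCenterSet (cycle (2 * n)) A
    → ∣ A ∣ ≤ n ⊎ ∣ A ∣ ≡ suc (2 * n)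
mainTheorem9 n _ A (S , S≠∅ , A⇔C) with any? (λ v → v ∈? A ×-dec n ≤? ecc (cycle (2 * n)) S v)
... | yes (v , v∈A , n≤r) = inj₂ (∀∈⇒∣p∣≡n A λ u →
  from (A⇔C u) (center-full (cycle (2 * n)) S (ecc≤radius S) (to (A⇔C v) v∈A) n≤r u))
  where open OddCycle n
... | no ¬wide = inj₁ (m+m≤1+2n⇒m≤n ∣ A ∣ n (gap2⇒∣p∣+∣p∣≤n A λ {v} v∈A v₂∈A →
  center-+ᶜ2-free S≠∅ (to (A⇔C v) v∈A) (≰⇒> (λ n≤r → ¬wide (v , v∈A , n≤r))) (to (A⇔C (v +ᶜ 2)) v₂∈A)))
  where open OddCycle n
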